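{- Let the credit of each element be $c(e)=f_R\cdot w^{\mathrm{LEV}}(e)$ with $f_R=8$, as defined in the context. Whenever $\textsc{Opt}$ performs a single swap of two elements at adjacent nodes of its tree (at cost $1$), while the online algorithm's tree remains unchanged, the total change of credits satisfies $\sum_{e\in E}\Delta c(e)\le 2\cdot f_R\cdot 1=16$.
   Context: An online algorithm and an offline algorithm $\textsc{Opt}$ maintain placements of the same $n$ elements $E$ on complete binary trees of the same shape (root at level $0$), one element per node. $\ell(e)$ is the level of $e$ in the online algorithm's tree and $\ell^{\mathrm{opt}}(e)$ its level in $\textsc{Opt}$'s tree. Level-weight: $w^{\mathrm{LEV}}(e)=\ell(e)-2\ell^{\mathrm{opt}}(e)-1$ if $\ell(e)\ge 2\ell^{\mathrm{opt}}(e)+2$, and $0$ otherwise. $\Delta c(e)$ is the change of $c(e)$ caused by the swap. -}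

module Defs where

open import Data.Nat using (ℕ; zero; suc; _+_; _*_; _∸_; _≤_; _≤?_)
open import Data.Nat.Logarithm using (⌊log₂_⌋)
open import Data.Fin using (Fin; toℕ; _≟_)
open import Data.Fin.Permutation using (Permutation′; _⟨$⟩ʳ_)
open import Data.Integer using (ℤ; +_; _-_) renaming (_+_ to _+ℤ_)
open import Data.Sum using (_⊎_)
open import Relation.Nullary using (yes; no)
open import Relation.Binary.PropositionalEquality using (_≡_)

-- Complete binary tree with n nodes, in heap (level-order) numbering:
-- node k : Fin n is position p = toℕ k + 1; the root is position 1, the
-- parent of position p ≥ 2 is position ⌊p/2⌋, and the level of position p
-- is ⌊log₂ p⌋ (root at level 0).
Node : ℕ → Set
Node n = Fin n

level : ∀ {n} → Node n → ℕ
level k = ⌊log₂ (suc (toℕ k)) ⌋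

IsParent : ∀ {n} → Node n → Node n → Set
IsParent u v = 2 * suc (toℕ u) ≡ suc (toℕ v) ⊎ 2 * suc (toℕ u) + 1 ≡ suc (toℕ v)

Adjacent : ∀ {n} → Node n → Node n → Set
Adjacent u v = IsParent u v ⊎ IsParent v u

-- A placement of the n elements E = Fin n on the nodes: a bijection E → Node n.
Placement : ℕ → Set
Placement n = Permutation′ n

nodeOf : ∀ {n} → Placement n → Fin n → Node n
nodeOf π e = π ⟨$⟩ʳ e

swapNode : ∀ {n} → Node n → Node n → Node n → Node n
swapNode a b x with x ≟ a
... | yes _ = b
... | no _ with x ≟ b
...   | yes _ = a
...   | no _ = x

wLEV : ℕ → ℕ → ℕ
wLEV ℓ ℓopt with 2 * ℓopt + 2 ≤? ℓ
... | yes _ = ℓ ∸ (2 * ℓopt) ∸ 1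
... | no _ = 0

fR : ℕ
fR = 8

credit : ℕ → ℕ → ℕ
credit ℓ ℓopt = fR * wLEV ℓ ℓopt

Σℤ : ∀ n → (Fin n → ℤ) → ℤ
Σℤ zero f = + 0
Σℤ (suc n) f = f Fin.zero +ℤ Σℤ n (λ i → f (Fin.suc i))

-- A swap along an edge of Opt's tree changes the Opt-level of only two elements:
-- the parent's element moves one level down, which can only lower its weight,
-- and the child's element moves one level up. Since wLEV ℓ k = ℓ ∸ (2k + 1), one
-- level up raises the weight by at most 2, so the total credit grows by at most 2 f_R.
module Submission where

open import Defs
open import Data.Nat as ℕ using (ℕ; zero; suc; _+_; _*_; _∸_; _≤?_; ⌊_/2⌋; z≤n; s≤s)
import Data.Nat.Properties as ℕ
open import Data.Nat.Logarithm using (⌊log₂_⌋; ⌊log₂⌋-mono-≤; ⌊log₂⌊n/2⌋⌋≡⌊log₂n⌋∸1)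
open import Data.Integer as ℤ using (ℤ; +_; _-_; _≤_; _⊖_)
import Data.Integer.Properties as ℤ
open import Data.Fin using (Fin; toℕ; _≟_)
open import Data.Fin.Properties using (suc-injective)
open import Data.Fin.Permutation using (_⟨$⟩ˡ_; inverseˡ)
open import Data.Sum using (_⊎_; inj₁; inj₂)
open import Data.Product using (∃-syntax; _×_; _,_)
open import Data.Empty using (⊥-elim)
open import Function using (_∘_)
open import Relation.Nullary using (yes; no; ¬_)
open import Relation.Binary.PropositionalEquality
  using (_≡_; refl; sym; trans; cong; subst; module ≡-Reasoning)

-- Truncated subtraction absorbs the threshold 2 ℓᵒᵖᵗ + 2 ≤ ℓ in the definition of wLEV.
wLEV≡ : ∀ ℓ k → wLEV ℓ k ≡ ℓ ∸ (2 * k + 1)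
wLEV≡ ℓ k with 2 * k + 2 ≤? ℓ
... | yes _   = ℕ.∸-+-assoc ℓ (2 * k) 1
... | no  ℓ≯ = sym (ℕ.m≤n⇒m∸n≡0 (ℕ.≤-pred (subst (suc ℓ ℕ.≤_) (ℕ.+-suc (2 * k) 1) (ℕ.≰⇒> ℓ≯))))

wLEV-antitone : ∀ ℓ {k k′} → k ℕ.≤ k′ → wLEV ℓ k′ ℕ.≤ wLEV ℓ k
wLEV-antitone ℓ {k} {k′} k≤k′ rewrite wLEV≡ ℓ k | wLEV≡ ℓ k′ =
  ℕ.∸-monoʳ-≤ ℓ (ℕ.+-monoˡ-≤ 1 (ℕ.*-monoʳ-≤ 2 k≤k′))

wLEV≤2*d+wLEV[d+k] : ∀ ℓ d k → wLEV ℓ k ℕ.≤ 2 * d + wLEV ℓ (d + k)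
wLEV≤2*d+wLEV[d+k] ℓ d k rewrite wLEV≡ ℓ k | wLEV≡ ℓ (d + k) =
  subst (λ t → x ℕ.≤ 2 * d + t) x∸2d≡ (ℕ.m≤n+m∸n x (2 * d))
  where
  open ≡-Reasoning
  x : ℕ
  x = ℓ ∸ (2 * k + 1)
  x∸2d≡ : x ∸ 2 * d ≡ ℓ ∸ (2 * (d + k) + 1)
  x∸2d≡ = begin
    ℓ ∸ (2 * k + 1) ∸ 2 * d     ≡⟨ ℕ.∸-+-assoc ℓ (2 * k + 1) (2 * d) ⟩
    ℓ ∸ (2 * k + 1 + 2 * d)     ≡⟨ cong (ℓ ∸_) (ℕ.+-comm (2 * k + 1) (2 * d)) ⟩
    ℓ ∸ (2 * d + (2 * k + 1))   ≡⟨ cong (ℓ ∸_) (sym (ℕ.+-assoc (2 * d) (2 * k) 1)) ⟩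
    ℓ ∸ (2 * d + 2 * k + 1)     ≡⟨ cong (λ t → ℓ ∸ (t + 1)) (sym (ℕ.*-distribˡ-+ 2 d k)) ⟩
    ℓ ∸ (2 * (d + k) + 1)       ∎

wLEV-raise : ∀ ℓ d {k k′} → k ℕ.≤ d + k′ → wLEV ℓ k′ ℕ.≤ 2 * d + wLEV ℓ k
wLEV-raise ℓ d {k} {k′} k≤d+k′ = ℕ.≤-trans (wLEV≤2*d+wLEV[d+k] ℓ d k′)
  (ℕ.+-monoʳ-≤ (2 * d) (wLEV-antitone ℓ k≤d+k′))

[+m]-[+n]≤+o : ∀ {m n o} → m ℕ.≤ n + o → + m - + n ≤ + o
[+m]-[+n]≤+o {m} {n} {o} m≤n+o = begin
  + m - + n          ≡⟨ ℤ.m-n≡m⊖n m n ⟩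
  m ⊖ n              ≤⟨ ℤ.⊖-monoˡ-≤ n m≤n+o ⟩
  (n + o) ⊖ n        ≡⟨ cong ((n + o) ⊖_) (sym (ℕ.+-identityʳ n)) ⟩
  (n + o) ⊖ (n + 0)  ≡⟨ ℤ.+-cancelˡ-⊖ n o 0 ⟩
  + o                ∎
  where open ℤ.≤-Reasoning

credit-raise : ∀ ℓ d {k k′} → k ℕ.≤ d + k′ → + credit ℓ k′ - + credit ℓ k ≤ + (2 * fR * d)
credit-raise ℓ d {k} {k′} k≤d+k′ = [+m]-[+n]≤+o {credit ℓ k′} {credit ℓ k} (begin
  fR * wLEV ℓ k′                   ≤⟨ ℕ.*-monoʳ-≤ fR (wLEV-raise ℓ d k≤d+k′) ⟩
  fR * (2 * d + wLEV ℓ k)          ≡⟨ ℕ.*-distribˡ-+ fR (2 * d) (wLEV ℓ k) ⟩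
  fR * (2 * d) + fR * wLEV ℓ k     ≡⟨ cong (_+ fR * wLEV ℓ k) (sym (ℕ.*-assoc fR 2 d)) ⟩
  fR * 2 * d + fR * wLEV ℓ k       ≡⟨ ℕ.+-comm (fR * 2 * d) (fR * wLEV ℓ k) ⟩
  fR * wLEV ℓ k + 2 * fR * d       ∎)
  where open ℕ.≤-Reasoning

⌊2*n+1/2⌋≡n : ∀ n → ⌊ 2 * n + 1 /2⌋ ≡ n
⌊2*n+1/2⌋≡n zero    = refl
⌊2*n+1/2⌋≡n (suc n) rewrite ℕ.+-suc n (n + 0) = cong suc (⌊2*n+1/2⌋≡n n)

⌊2*n/2⌋≡n : ∀ n → ⌊ 2 * n /2⌋ ≡ n
⌊2*n/2⌋≡n n = sym (trans (ℕ.n≡⌊n+n/2⌋ n) (cong (λ t → ⌊ n + t /2⌋) (sym (ℕ.+-identityʳ n))))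

parent-position : ∀ {n} {u v : Node n} → IsParent u v → ⌊ suc (toℕ v) /2⌋ ≡ suc (toℕ u)
parent-position {u = u} (inj₁ eq) = subst (λ c → ⌊ c /2⌋ ≡ suc (toℕ u)) eq (⌊2*n/2⌋≡n (suc (toℕ u)))
parent-position {u = u} (inj₂ eq) = subst (λ c → ⌊ c /2⌋ ≡ suc (toℕ u)) eq (⌊2*n+1/2⌋≡n (suc (toℕ u)))

⌊log₂⌋-half : ∀ n {m} → ⌊ n /2⌋ ≡ suc m → ⌊log₂ n ⌋ ≡ suc ⌊log₂ suc m ⌋
⌊log₂⌋-half (suc (suc k)) {m} half≡ = begin
  ⌊log₂ n ⌋               ≡⟨ ℕ.+-∸-assoc 1 {⌊log₂ n ⌋} {1} (⌊log₂⌋-mono-≤ {2} {n} (s≤s (s≤s z≤n))) ⟩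
  suc (⌊log₂ n ⌋ ∸ 1)      ≡⟨ cong suc (sym (⌊log₂⌊n/2⌋⌋≡⌊log₂n⌋∸1 n)) ⟩
  suc ⌊log₂ ⌊ n /2⌋ ⌋      ≡⟨ cong (λ t → suc ⌊log₂ t ⌋) half≡ ⟩
  suc ⌊log₂ suc m ⌋        ∎
  where
  open ≡-Reasoning
  n : ℕ
  n = suc (suc k)

level-child : ∀ {n} {u v : Node n} → IsParent u v → level v ≡ suc (level u)
level-child {v = v} u→v = ⌊log₂⌋-half (suc (toℕ v)) (parent-position u→v)

RaisesOnly : ∀ {n} → (Node n → Node n) → Node n → Set
RaisesOnly σ v = ∀ p → level p ℕ.≤ level (σ p) ⊎ (p ≡ v × level p ℕ.≤ 1 + level (σ p))

swapNode-adjacent-raisesOnly : ∀ {n} {a b : Node n} → Adjacent a b → ∃[ v ] RaisesOnly (swapNode a b) v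
swapNode-adjacent-raisesOnly {a = a} {b} (inj₁ a→b) = b , raises
  where
  raises : RaisesOnly (swapNode a b) b
  raises p with p ≟ a
  ... | yes refl = inj₁ (ℕ.≤-trans (ℕ.n≤1+n (level a)) (ℕ.≤-reflexive (sym (level-child a→b))))
  ... | no  _ with p ≟ b
  ...   | yes refl = inj₂ (refl , ℕ.≤-reflexive (level-child a→b))
  ...   | no  _    = inj₁ ℕ.≤-refl
swapNode-adjacent-raisesOnly {a = a} {b} (inj₂ b→a) = a , raises
  where
  raises : RaisesOnly (swapNode a b) a
  raises p with p ≟ a
  ... | yes refl = inj₂ (refl , ℕ.≤-reflexive (level-child b→a))
  ... | no  _ with p ≟ b
  ...   | yes refl = inj₁ (ℕ.≤-trans (ℕ.n≤1+n (level b)) (ℕ.≤-reflexive (sym (level-child b→a))))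
  ...   | no  _    = inj₁ ℕ.≤-refl

Σℤ-nonpos : ∀ n (h : Fin n → ℤ) → (∀ e → h e ≤ + 0) → Σℤ n h ≤ + 0
Σℤ-nonpos zero    h h≤0 = ℤ.≤-refl
Σℤ-nonpos (suc n) h h≤0 = ℤ.+-mono-≤ (h≤0 Fin.zero) (Σℤ-nonpos n (λ i → h (Fin.suc i)) (λ i → h≤0 (Fin.suc i)))

Σℤ-≤-single : ∀ n (h : Fin n → ℤ) {K} e₀ → (∀ e → ¬ e ≡ e₀ → h e ≤ + 0) → h e₀ ≤ + K → Σℤ n h ≤ + K
Σℤ-≤-single (suc n) h {K} Fin.zero others h₀≤K =
  subst (λ t → Σℤ (suc n) h ≤ + t) (ℕ.+-identityʳ K)
    (ℤ.+-mono-≤ h₀≤K (Σℤ-nonpos n (λ i → h (Fin.suc i)) (λ i → others (Fin.suc i) λ ())))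
Σℤ-≤-single (suc n) h (Fin.suc e₀) others h₀≤K =
  ℤ.+-mono-≤ (others Fin.zero λ ())
    (Σℤ-≤-single n (λ i → h (Fin.suc i)) e₀ (λ e e≢ → others (Fin.suc e) (e≢ ∘ suc-injective)) h₀≤K)

lemma8 : (n : ℕ) (alg opt opt′ : Placement n) (a b : Node n) → Adjacent a b → (∀ e → nodeOf opt′ e ≡ swapNode a b (nodeOf opt e)) → Σℤ n (λ e → + credit (level (nodeOf alg e)) (level (nodeOf opt′ e)) - + credit (level (nodeOf alg e)) (level (nodeOf opt e))) ≤ + (2 * fR * 1)
lemma8 n alg opt opt′ a b adj opt′≡swap with swapNode-adjacent-raisesOnly adj
... | v , raises = Σℤ-≤-single n Δ e₀ others raised
  where
  ℓ : Fin n → ℕ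
  ℓ e = level (nodeOf alg e)
  Δ : Fin n → ℤ
  Δ e = + credit (ℓ e) (level (nodeOf opt′ e)) - + credit (ℓ e) (level (nodeOf opt e))
  e₀ : Fin n
  e₀ = opt ⟨$⟩ˡ v
  moves : ∀ e → level (nodeOf opt e) ℕ.≤ level (nodeOf opt′ e)
              ⊎ (nodeOf opt e ≡ v × level (nodeOf opt e) ℕ.≤ 1 + level (nodeOf opt′ e))
  moves e rewrite opt′≡swap e = raises (nodeOf opt e)
  others : ∀ e → ¬ e ≡ e₀ → Δ e ≤ + 0
  others e e≢e₀ with moves e
  ... | inj₁ deeper     = credit-raise (ℓ e) 0 deeper
  ... | inj₂ (at-v , _) = ⊥-elim (e≢e₀ (trans (sym (inverseˡ opt)) (cong (opt ⟨$⟩ˡ_) at-v)))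
  raised : Δ e₀ ≤ + (2 * fR * 1)
  raised with moves e₀
  ... | inj₁ deeper = ℤ.≤-trans (credit-raise (ℓ e₀) 0 deeper) (ℤ.+≤+ z≤n)
  ... | inj₂ (_ , up) = credit-raise (ℓ e₀) 1 up
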